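{- Let $a_1,\dots,a_d$ be pairwise relatively prime positive integers. Then, as polynomials in $t$, \[\mathrm{poly}_{\{ -a_1,-a_2,\dots,-a_d\}}(t)=\sum_{k=1}^{d}(-1)^k\sum_{1\le i_1<\cdots<i_k\le d}\mathrm{poly}_{\{a_{i_1},\dots,a_{i_k}\}}(t).\]
   Context: For nonzero integers $c_1,\dots,c_d$, define the polynomial \[\mathrm{poly}_{\{c_1,\dots,c_d\}}(t)=\frac{1}{c_1\cdots c_d}\sum_{m=0}^{d-1}\frac{(-1)^m}{(d-1-m)!}\sum_{k_1+\cdots+k_d=m}c_1^{k_1}\cdots c_d^{k_d}\frac{B_{k_1}\cdots B_{k_d}}{k_1!\cdots k_d!}t^{d-1-m},\] where $k_i\ge0$ and $B_j$ is the $j$th Bernoulli number ($B_0=1$, $B_1=-\tfrac12$, $B_2=\tfrac16,\dots$). For positive pairwise coprime $c_i$ this is the polynomial part of the restricted partition function $p_{\{c_1,\dots,c_d\}}(n)=\#\{(m_1,\dots,m_d)\in\mathbb{Z}_{\ge0}^d: m_1c_1+\cdots+m_dc_d=n\}$. -}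

module Defs where

open import Data.Nat as ℕ using (ℕ; zero; suc; _∸_; _<ᵇ_; _≡ᵇ_)
open import Data.Nat.Properties using (_!≢0)
open import Data.Nat.Combinatorics using (_C_)
open import Data.Bool using (Bool; true; false; if_then_else_)
open import Data.Integer as ℤ using (ℤ; +_)
open import Data.Rational as ℚ using (ℚ; 0ℚ; 1ℚ; _+_; _*_; -_; 1/_; _/_)
open import Data.Rational.Properties using (_≟_)
open import Data.List as List using (List; []; _∷_; length; map; concatMap; upTo; foldr)
open import Data.Vec as Vec using (Vec; []; _∷_; _∷ʳ_; lookup)
open import Data.Fin using (Fin; toℕ)
open import Relation.Nullary using (yes; no)

Σℚ : List ℚ → ℚ
Σℚ = foldr _+_ 0ℚ

Πℚ : List ℚ → ℚ
Πℚ = foldr _*_ 1ℚ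

Σ<_ : ℕ → (ℕ → ℚ) → ℚ
(Σ< n) f = Σℚ (map f (upTo n))

ℤ→ℚ : ℤ → ℚ
ℤ→ℚ z = z / 1

ℕ→ℚ : ℕ → ℚ
ℕ→ℚ n = (+ n) / 1

_^_ : ℚ → ℕ → ℚ
x ^ zero  = 1ℚ
x ^ suc n = x * (x ^ n)

sgn : ℕ → ℚ
sgn n = (- 1ℚ) ^ n

inv! : ℕ → ℚ
inv! n = (+ 1 / (n ℕ.!)) {{n !≢0}}

-- total inverse (used only on nonzero arguments)
inv : ℚ → ℚ
inv p with p ≟ 0ℚ
... | yes _ = 0ℚ
... | no p≢0 = (1/ p) {{ℚ.≢-nonZero p≢0}}

-- Bernoulli numbers with B₀ = 1, B₁ = -1/2, B₂ = 1/6, ...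
-- defined by the standard recursion  Σ_{k=0}^{n} C(n+1,k) B_k = 0  (n ≥ 1).
-- bernVec n = [B₀, …, B_n]

bernVec : (n : ℕ) → Vec ℚ (suc n)
bernVec zero    = 1ℚ ∷ []
bernVec (suc n) = bernVec n ∷ʳ next
  where
  prev : Vec ℚ (suc n)
  prev = bernVec n
  sumPrev : ℚ
  sumPrev = Σℚ (Vec.toList (Vec.zipWith (λ b k → ℕ→ℚ ((suc (suc n)) C k) * b) prev (Vec.tabulate toℕ)))
  next : ℚ
  next = - (((+ 1) / (suc (suc n))) * sumPrev)

B : ℕ → ℚ
B n = Vec.last (bernVec n)

compositions : (d : ℕ) → ℕ → List (Vec ℕ d)
compositions zero    zero    = [] ∷ []
compositions zero    (suc _) = []
compositions (suc d) m =
  concatMap (λ k → map (k ∷_) (compositions d (m ∸ k))) (upTo (suc m))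

innerSum : (cs : List ℤ) → ℕ → ℚ
innerSum cs m =
  Σℚ (map (λ ks → Πℚ (Vec.toList (Vec.zipWith (λ c k → (ℤ→ℚ c ^ k) * B k * inv! k)
                                                  (Vec.fromList cs) ks)))
          (compositions (length cs) m))

-- Polynomials in t with rational coefficients, represented by their
-- coefficient sequence (coefficient of t^j at index j; finitely supported).

Poly : Set
Poly = ℕ → ℚ

_⊕_ : Poly → Poly → Poly
(p ⊕ q) j = p j + q j

_⊙_ : ℚ → Poly → Poly
(a ⊙ p) j = a * p j

zeroP : Poly
zeroP _ = 0ℚ

mono : ℚ → ℕ → Poly
mono a n j = if j ≡ᵇ n then a else 0ℚ

ΣP : List Poly → Poly
ΣP = foldr _⊕_ zeroP

poly : List ℤ → Poly
poly cs = inv (Πℚ (map ℤ→ℚ cs)) ⊙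
  ΣP (map (λ m → mono (sgn m * inv! (d ∸ 1 ∸ m) * innerSum cs m) (d ∸ 1 ∸ m))
          (upTo d))
  where d = length cs

-- sublists of a given length k (as subsequences i₁ < ⋯ < i_k, order kept)

choose : {A : Set} → ℕ → List A → List (List A)
choose zero    _        = [] ∷ []
choose (suc k) []       = []
choose (suc k) (x ∷ xs) = map (x ∷_) (choose k xs) List.++ choose (suc k) xs

open import Data.List.Relation.Unary.AllPairs using (AllPairs)
open import Data.Nat.Coprimality using (Coprime)

PairwiseCoprime : List ℕ → Set
PairwiseCoprime = AllPairs Coprime

-- Write F_c(x) = Σ_k c^k B_k x^k / k! = c x / (e^{c x} − 1), so that innerSum cs lists the
-- coefficients of the product of the F_c over c ∈ cs, from which poly cs is read off.
-- Since x / (eˣ − 1) + x / 2 is even, F_{−a}(x) = F_a(x) + a x; on power series this follows from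
-- F_1(x) (eˣ − 1) = x, which is the recursion defining B, and from eˣ e^{−x} = 1. Multiplying out,
-- innerSum (−a ∷ cs) = innerSum (a ∷ cs) + a x · innerSum cs, and in poly the factor x costs one
-- degree and a sign while a cancels against the prefactor 1/(−a ⋯), so
-- poly (−a ∷ cs) = poly cs − poly (a ∷ cs). Flipping the signs of a_1, …, a_d one at a time
-- then expands poly_{−a_1,…,−a_d} into the alternating sum over all subsets.

module Submission where

open import Defs
open import Data.Nat as ℕ using (ℕ; zero; suc; _∸_; _<_; _≤_; z≤n; s≤s; _!; _≡ᵇ_; NonZero)
import Data.Nat.Properties as ℕₚ
open import Data.Nat.Combinatorics using (_C_)
import Data.Nat.Combinatorics as ℕC
import Data.Nat.DivMod as ℕ
import Data.Nat.Coprimality as Coprimality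
open import Data.Integer as ℤ using (ℤ)
import Data.Integer.Properties as ℤₚ
open import Data.Rational as ℚ using (ℚ; mkℚ; 0ℚ; 1ℚ; _+_; _*_; -_; 1/_)
open import Data.Rational.Properties as ℚₚ using (_≟_)
open import Data.Rational.Solver using (module +-*-Solver)
open import Data.List using (List; []; _∷_; map; upTo; applyUpTo; _++_; length; concatMap)
import Data.List.Properties as Listₚ
open import Data.List.Relation.Unary.All using (All; []; _∷_)
open import Data.Vec as Vec using (Vec; _∷ʳ_)
import Data.Vec.Properties as Vecₚ
open import Data.Bool using (true; false)
open import Data.Fin using (toℕ)
open import Data.Product using (_,_)
open import Data.Empty using (⊥-elim)
open import Function using (_∘_; id)
open import Relation.Nullary using (Dec; yes; no)
open import Relation.Binary.PropositionalEquality
open +-*-Solver using (solve; _:+_; _:*_; :-_; _:=_; con)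

∑ : ℕ → (ℕ → ℚ) → ℚ
∑ n f = Σℚ (applyUpTo f n)

map-applyUpTo : ∀ {A B : Set} (f : A → B) (g : ℕ → A) n →
                map f (applyUpTo g n) ≡ applyUpTo (f ∘ g) n
map-applyUpTo f g zero    = refl
map-applyUpTo f g (suc n) = cong (f (g 0) ∷_) (map-applyUpTo f (g ∘ suc) n)

Σ<≡∑ : ∀ n f → (Σ< n) f ≡ ∑ n f
Σ<≡∑ n f = cong Σℚ (map-applyUpTo f id n)

∑-cong-< : ∀ n {f g} → (∀ k → k < n → f k ≡ g k) → ∑ n f ≡ ∑ n g
∑-cong-< zero    eq = refl
∑-cong-< (suc n) eq = cong₂ _+_ (eq 0 (s≤s z≤n)) (∑-cong-< n (λ k k<n → eq (suc k) (s≤s k<n)))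

∑-cong : ∀ n {f g} → f ≗ g → ∑ n f ≡ ∑ n g
∑-cong n eq = ∑-cong-< n (λ k _ → eq k)

∑-+ : ∀ n f g → ∑ n (λ k → f k + g k) ≡ ∑ n f + ∑ n g
∑-+ zero    f g = refl
∑-+ (suc n) f g = begin
  (f 0 + g 0) + ∑ n (λ k → f (suc k) + g (suc k)) ≡⟨ cong ((f 0 + g 0) +_) (∑-+ n (f ∘ suc) (g ∘ suc)) ⟩
  (f 0 + g 0) + (∑ n (f ∘ suc) + ∑ n (g ∘ suc))   ≡⟨ solve 4 (λ a b c d → (a :+ b) :+ (c :+ d) := (a :+ c) :+ (b :+ d))
                                                              refl (f 0) (g 0) (∑ n (f ∘ suc)) (∑ n (g ∘ suc)) ⟩
  (f 0 + ∑ n (f ∘ suc)) + (g 0 + ∑ n (g ∘ suc))   ∎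
  where open ≡-Reasoning

∑-*ˡ : ∀ n a f → ∑ n (λ k → a * f k) ≡ a * ∑ n f
∑-*ˡ zero    a f = sym (ℚₚ.*-zeroʳ a)
∑-*ˡ (suc n) a f = trans (cong (a * f 0 +_) (∑-*ˡ n a (f ∘ suc))) (sym (ℚₚ.*-distribˡ-+ a (f 0) _))

∑-neg : ∀ n f → ∑ n (λ k → - f k) ≡ - ∑ n f
∑-neg zero    f = refl
∑-neg (suc n) f = trans (cong (- f 0 +_) (∑-neg n (f ∘ suc))) (sym (ℚₚ.neg-distrib-+ (f 0) _))

∑-last : ∀ n f → ∑ (suc n) f ≡ ∑ n f + f n
∑-last zero    f = trans (ℚₚ.+-identityʳ (f 0)) (sym (ℚₚ.+-identityˡ (f 0)))
∑-last (suc n) f = trans (cong (f 0 +_) (∑-last n (f ∘ suc))) (sym (ℚₚ.+-assoc (f 0) _ _))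

Σℚ-++ : ∀ xs ys → Σℚ (xs ++ ys) ≡ Σℚ xs + Σℚ ys
Σℚ-++ []       ys = sym (ℚₚ.+-identityˡ _)
Σℚ-++ (x ∷ xs) ys = trans (cong (x +_) (Σℚ-++ xs ys)) (sym (ℚₚ.+-assoc x _ _))

Σℚ-map-cong : ∀ {A : Set} {f g : A → ℚ} (xs : List A) → f ≗ g → Σℚ (map f xs) ≡ Σℚ (map g xs)
Σℚ-map-cong xs eq = cong Σℚ (Listₚ.map-cong eq xs)

Σℚ-map-*ˡ : ∀ {A : Set} a (f : A → ℚ) (xs : List A) → Σℚ (map (λ x → a * f x) xs) ≡ a * Σℚ (map f xs)
Σℚ-map-*ˡ a f []       = sym (ℚₚ.*-zeroʳ a)
Σℚ-map-*ˡ a f (x ∷ xs) = trans (cong (a * f x +_) (Σℚ-map-*ˡ a f xs)) (sym (ℚₚ.*-distribˡ-+ a (f x) _))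

Σℚ-concatMap : ∀ {A B : Set} (f : B → ℚ) (g : A → List B) (xs : List A) →
               Σℚ (map f (concatMap g xs)) ≡ Σℚ (map (λ x → Σℚ (map f (g x))) xs)
Σℚ-concatMap f g []       = refl
Σℚ-concatMap f g (x ∷ xs) = begin
  Σℚ (map f (g x ++ concatMap g xs))                  ≡⟨ cong Σℚ (Listₚ.map-++ f (g x) (concatMap g xs)) ⟩
  Σℚ (map f (g x) ++ map f (concatMap g xs))          ≡⟨ Σℚ-++ (map f (g x)) (map f (concatMap g xs)) ⟩
  Σℚ (map f (g x)) + Σℚ (map f (concatMap g xs))      ≡⟨ cong (Σℚ (map f (g x)) +_) (Σℚ-concatMap f g xs) ⟩
  Σℚ (map f (g x)) + Σℚ (map (λ y → Σℚ (map f (g y))) xs) ∎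
  where open ≡-Reasoning

ΣP-apply : ∀ {A : Set} (p : A → Poly) (xs : List A) j → ΣP (map p xs) j ≡ Σℚ (map (λ x → p x j) xs)
ΣP-apply p []       j = refl
ΣP-apply p (x ∷ xs) j = cong (p x j +_) (ΣP-apply p xs j)

-- Formal power series under the Cauchy product

Series : Set
Series = ℕ → ℚ

infixl 7 _∗_

_∗_ : Series → Series → Series
(f ∗ g) n = ∑ (suc n) (λ k → f k * g (n ∸ k))

δ₀ : Series
δ₀ zero    = 1ℚ
δ₀ (suc _) = 0ℚ

δ₁ : Series
δ₁ zero    = 0ℚ
δ₁ (suc k) = δ₀ k

shift : Series → Series
shift f zero    = 0ℚ
shift f (suc n) = f n

∗-congˡ : ∀ {f f′} g → f ≗ f′ → f ∗ g ≗ f′ ∗ g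
∗-congˡ g eq n = ∑-cong (suc n) (λ k → cong (_* g (n ∸ k)) (eq k))

∗-congʳ : ∀ f {g g′} → g ≗ g′ → f ∗ g ≗ f ∗ g′
∗-congʳ f eq n = ∑-cong (suc n) (λ k → cong (f k *_) (eq (n ∸ k)))

∗-unfold : ∀ f g n → (f ∗ g) n ≡ f 0 * g n + shift ((f ∘ suc) ∗ g) n
∗-unfold f g zero    = refl
∗-unfold f g (suc n) = refl

-- Both sides are Σ_{i+j+k=n} f_i g_j h_k.
∗-swap : ∀ f g h → f ∗ (g ∗ h) ≗ g ∗ (f ∗ h)
∗-swap f g h zero =
  solve 3 (λ a b c → a :* (b :* c :+ con 0ℚ) :+ con 0ℚ := b :* (a :* c :+ con 0ℚ) :+ con 0ℚ) refl (f 0) (g 0) (h 0)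
∗-swap f g h (suc n) = begin
  f 0 * (g ∗ h) (suc n) + (f′ ∗ (g ∗ h)) n
    ≡⟨ cong (f 0 * (g ∗ h) (suc n) +_) (trans (∗-swap f′ g h n) (∗-unfold g (f′ ∗ h) n)) ⟩
  f 0 * (g 0 * h (suc n) + (g′ ∗ h) n) + (g 0 * (f′ ∗ h) n + shift (g′ ∗ (f′ ∗ h)) n)
    ≡⟨ cong (λ t → f 0 * (g 0 * h (suc n) + (g′ ∗ h) n) + (g 0 * (f′ ∗ h) n + t)) (tails n) ⟩
  f 0 * (g 0 * h (suc n) + (g′ ∗ h) n) + (g 0 * (f′ ∗ h) n + shift (f′ ∗ (g′ ∗ h)) n)
    ≡⟨ solve 6 (λ a b c x y t → a :* (b :* c :+ x) :+ (b :* y :+ t) := b :* (a :* c :+ y) :+ (a :* x :+ t))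
         refl (f 0) (g 0) (h (suc n)) ((g′ ∗ h) n) ((f′ ∗ h) n) (shift (f′ ∗ (g′ ∗ h)) n) ⟩
  g 0 * (f 0 * h (suc n) + (f′ ∗ h) n) + (f 0 * (g′ ∗ h) n + shift (f′ ∗ (g′ ∗ h)) n)
    ≡⟨ cong (g 0 * (f ∗ h) (suc n) +_) (sym (trans (∗-swap g′ f h n) (∗-unfold f (g′ ∗ h) n))) ⟩
  g 0 * (f ∗ h) (suc n) + (g′ ∗ (f ∗ h)) n ∎
  where
  open ≡-Reasoning
  f′ g′ : Series
  f′ = f ∘ suc
  g′ = g ∘ suc
  tails : ∀ m → shift (g′ ∗ (f′ ∗ h)) m ≡ shift (f′ ∗ (g′ ∗ h)) m
  tails zero    = refl
  tails (suc m) = ∗-swap g′ f′ h m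

∗-identityʳ : ∀ f → f ∗ δ₀ ≗ f
∗-identityʳ f zero    = trans (ℚₚ.+-identityʳ (f 0 * 1ℚ)) (ℚₚ.*-identityʳ (f 0))
∗-identityʳ f (suc n) =
  trans (cong₂ _+_ (ℚₚ.*-zeroʳ (f 0)) (∗-identityʳ (f ∘ suc) n)) (ℚₚ.+-identityˡ (f (suc n)))

∗-comm : ∀ f g → f ∗ g ≗ g ∗ f
∗-comm f g n = begin
  (f ∗ g) n        ≡⟨ ∗-congʳ f (λ m → sym (∗-identityʳ g m)) n ⟩
  (f ∗ (g ∗ δ₀)) n ≡⟨ ∗-swap f g δ₀ n ⟩
  (g ∗ (f ∗ δ₀)) n ≡⟨ ∗-congʳ g (∗-identityʳ f) n ⟩
  (g ∗ f) n        ∎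
  where open ≡-Reasoning

∗-identityˡ : ∀ g → δ₀ ∗ g ≗ g
∗-identityˡ g n = trans (∗-comm δ₀ g n) (∗-identityʳ g n)

δ₁-∗ : ∀ g → δ₁ ∗ g ≗ shift g
δ₁-∗ g zero    = trans (ℚₚ.+-identityʳ (0ℚ * g 0)) (ℚₚ.*-zeroˡ (g 0))
δ₁-∗ g (suc n) = trans (cong₂ _+_ (ℚₚ.*-zeroˡ (g (suc n))) (∗-identityˡ g n)) (ℚₚ.+-identityˡ (g n))

∗-distribʳ-⊕ : ∀ f f′ g → (f ⊕ f′) ∗ g ≗ (f ∗ g) ⊕ (f′ ∗ g)
∗-distribʳ-⊕ f f′ g n =
  trans (∑-cong (suc n) (λ k → ℚₚ.*-distribʳ-+ (g (n ∸ k)) (f k) (f′ k)))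
        (∑-+ (suc n) (λ k → f k * g (n ∸ k)) (λ k → f′ k * g (n ∸ k)))

∗-distribˡ-⊕ : ∀ f g g′ → f ∗ (g ⊕ g′) ≗ (f ∗ g) ⊕ (f ∗ g′)
∗-distribˡ-⊕ f g g′ n = begin
  (f ∗ (g ⊕ g′)) n              ≡⟨ ∗-comm f (g ⊕ g′) n ⟩
  ((g ⊕ g′) ∗ f) n              ≡⟨ ∗-distribʳ-⊕ g g′ f n ⟩
  (g ∗ f) n + (g′ ∗ f) n        ≡⟨ cong₂ _+_ (∗-comm g f n) (∗-comm g′ f n) ⟩
  (f ∗ g) n + (f ∗ g′) n        ∎
  where open ≡-Reasoning

∗-⊙ˡ : ∀ a f g → (a ⊙ f) ∗ g ≗ a ⊙ (f ∗ g)
∗-⊙ˡ a f g n =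
  trans (∑-cong (suc n) (λ k → ℚₚ.*-assoc a (f k) (g (n ∸ k)))) (∑-*ˡ (suc n) a (λ k → f k * g (n ∸ k)))

∗-negˡ : ∀ f g n → ((λ k → - f k) ∗ g) n ≡ - (f ∗ g) n
∗-negˡ f g n =
  trans (∑-cong (suc n) (λ k → sym (ℚₚ.neg-distribˡ-* (f k) (g (n ∸ k))))) (∑-neg (suc n) (λ k → f k * g (n ∸ k)))

∗-negʳ : ∀ f g n → (f ∗ (λ k → - g k)) n ≡ - (f ∗ g) n
∗-negʳ f g n = trans (∗-comm f (λ k → - g k) n) (trans (∗-negˡ g f n) (cong -_ (∗-comm g f n)))

sgn-+ : ∀ a b → sgn (a ℕ.+ b) ≡ sgn a * sgn b
sgn-+ zero    b = sym (ℚₚ.*-identityˡ (sgn b))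
sgn-+ (suc a) b = trans (cong (- 1ℚ *_) (sgn-+ a b)) (sym (ℚₚ.*-assoc (- 1ℚ) (sgn a) (sgn b)))

alternate : Series → Series
alternate f k = sgn k * f k

alternate-∗ : ∀ f g → alternate (f ∗ g) ≗ alternate f ∗ alternate g
alternate-∗ f g n = trans (sym (∑-*ˡ (suc n) (sgn n) (λ k → f k * g (n ∸ k)))) (∑-cong-< (suc n) term)
  where
  term : ∀ k → k < suc n → sgn n * (f k * g (n ∸ k)) ≡ (sgn k * f k) * (sgn (n ∸ k) * g (n ∸ k))
  term k (s≤s k≤n) = begin
    sgn n * (f k * g (n ∸ k))                   ≡⟨ cong (λ m → sgn m * (f k * g (n ∸ k))) (sym (ℕₚ.m+[n∸m]≡n k≤n)) ⟩
    sgn (k ℕ.+ (n ∸ k)) * (f k * g (n ∸ k))     ≡⟨ cong (_* (f k * g (n ∸ k))) (sgn-+ k (n ∸ k)) ⟩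
    (sgn k * sgn (n ∸ k)) * (f k * g (n ∸ k))   ≡⟨ solve 4 (λ a b x y → (a :* b) :* (x :* y) := (a :* x) :* (b :* y))
                                                     refl (sgn k) (sgn (n ∸ k)) (f k) (g (n ∸ k)) ⟩
    (sgn k * f k) * (sgn (n ∸ k) * g (n ∸ k))   ∎
    where open ≡-Reasoning

*-inv : ∀ x → x ≢ 0ℚ → x * inv x ≡ 1ℚ
*-inv x x≢0 with x ≟ 0ℚ
... | yes x≡0 = ⊥-elim (x≢0 x≡0)
... | no  x≢0′ = ℚₚ.*-inverseʳ x {{ℚ.≢-nonZero x≢0′}}

inv-unique : ∀ x y → x * y ≡ 1ℚ → inv x ≡ y
inv-unique x y xy≡1 with x ≟ 0ℚ
... | yes refl = ⊥-elim (ℚₚ.1≢0 (trans (sym xy≡1) (ℚₚ.*-zeroˡ y)))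
... | no  x≢0  = begin
  1/ x            ≡⟨ sym (ℚₚ.*-identityʳ (1/ x)) ⟩
  1/ x * 1ℚ       ≡⟨ cong (1/ x *_) (sym xy≡1) ⟩
  1/ x * (x * y)  ≡⟨ sym (ℚₚ.*-assoc (1/ x) x y) ⟩
  (1/ x * x) * y  ≡⟨ cong (_* y) (ℚₚ.*-inverseˡ x) ⟩
  1ℚ * y          ≡⟨ ℚₚ.*-identityˡ y ⟩
  y               ∎
  where
  open ≡-Reasoning
  instance _ = ℚ.≢-nonZero x≢0

inv-* : ∀ x y → inv (x * y) ≡ inv x * inv y
inv-* x y = by-cases (x ≟ 0ℚ) (y ≟ 0ℚ)
  where
  open ≡-Reasoning
  by-cases : Dec (x ≡ 0ℚ) → Dec (y ≡ 0ℚ) → inv (x * y) ≡ inv x * inv y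
  by-cases (yes refl) _          = trans (cong inv (ℚₚ.*-zeroˡ y)) (sym (ℚₚ.*-zeroˡ (inv y)))
  by-cases (no _)     (yes refl) = trans (cong inv (ℚₚ.*-zeroʳ x)) (sym (ℚₚ.*-zeroʳ (inv x)))
  by-cases (no x≢0)   (no y≢0)   = inv-unique (x * y) (inv x * inv y) (begin
    (x * y) * (inv x * inv y)  ≡⟨ solve 4 (λ a b c d → (a :* b) :* (c :* d) := (a :* c) :* (b :* d)) refl x y (inv x) (inv y) ⟩
    (x * inv x) * (y * inv y)  ≡⟨ cong₂ _*_ (*-inv x x≢0) (*-inv y y≢0) ⟩
    1ℚ                         ∎)

inv-neg : ∀ x → inv (- x) ≡ - inv x
inv-neg x = by-cases (x ≟ 0ℚ)
  where
  by-cases : Dec (x ≡ 0ℚ) → inv (- x) ≡ - inv x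
  by-cases (yes refl) = refl
  by-cases (no x≢0)   = inv-unique (- x) (- inv x)
    (trans (solve 2 (λ a b → (:- a) :* (:- b) := a :* b) refl x (inv x)) (*-inv x x≢0))

ℤ→ℚ≡mkℚ : ∀ z → ℤ→ℚ z ≡ mkℚ z 0 (Coprimality.sym (Coprimality.1-coprimeTo ℤ.∣ z ∣))
ℤ→ℚ≡mkℚ z = ℚₚ.↥p/↧p≡p (mkℚ z 0 (Coprimality.sym (Coprimality.1-coprimeTo ℤ.∣ z ∣)))

ℤ→ℚ-neg : ∀ z → ℤ→ℚ (ℤ.- z) ≡ - ℤ→ℚ z
ℤ→ℚ-neg z = trans (ℤ→ℚ≡mkℚ (ℤ.- z)) (trans (mkℚ-neg z) (cong -_ (sym (ℤ→ℚ≡mkℚ z))))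
  where
  mkℚ-neg : ∀ z → mkℚ (ℤ.- z) 0 (Coprimality.sym (Coprimality.1-coprimeTo ℤ.∣ ℤ.- z ∣))
                ≡ - mkℚ z 0 (Coprimality.sym (Coprimality.1-coprimeTo ℤ.∣ z ∣))
  mkℚ-neg (ℤ.+ zero)  = refl
  mkℚ-neg (ℤ.+ suc n) = refl
  mkℚ-neg ℤ.-[1+ n ]  = refl

ℤ→ℚ-+ : ∀ x y → ℤ→ℚ (x ℤ.+ y) ≡ ℤ→ℚ x + ℤ→ℚ y
ℤ→ℚ-+ x y = begin
  ℤ→ℚ (x ℤ.+ y)                      ≡⟨ cong ℤ→ℚ (sym (cong₂ ℤ._+_ (ℤₚ.*-identityʳ x) (ℤₚ.*-identityʳ y))) ⟩
  ℤ→ℚ (x ℤ.* ℤ.+ 1 ℤ.+ y ℤ.* ℤ.+ 1)  ≡⟨ sym (cong₂ _+_ (ℤ→ℚ≡mkℚ x) (ℤ→ℚ≡mkℚ y)) ⟩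
  ℤ→ℚ x + ℤ→ℚ y                      ∎
  where open ≡-Reasoning

ℕ→ℚ-+ : ∀ a b → ℕ→ℚ (a ℕ.+ b) ≡ ℕ→ℚ a + ℕ→ℚ b
ℕ→ℚ-+ a b = trans (cong ℤ→ℚ (ℤₚ.pos-+ a b)) (ℤ→ℚ-+ (ℤ.+ a) (ℤ.+ b))

ℕ→ℚ-* : ∀ a b → ℕ→ℚ (a ℕ.* b) ≡ ℕ→ℚ a * ℕ→ℚ b
ℕ→ℚ-* a b = trans (cong ℤ→ℚ (ℤₚ.pos-* a b)) (sym (cong₂ _*_ (ℤ→ℚ≡mkℚ (ℤ.+ a)) (ℤ→ℚ≡mkℚ (ℤ.+ b))))

ℕ→ℚ-suc≢0 : ∀ n → ℕ→ℚ (suc n) ≢ 0ℚ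
ℕ→ℚ-suc≢0 n eq with ℚₚ.mkℚ-injective (trans (sym (ℤ→ℚ≡mkℚ (ℤ.+ suc n))) eq)
... | () , _

ℕ→ℚ-*-1/ : ∀ m .{{_ : NonZero m}} → ℕ→ℚ m * (ℤ.+ 1 ℚ./ m) ≡ 1ℚ
ℕ→ℚ-*-1/ (suc m) = trans
  (cong₂ _*_ (ℤ→ℚ≡mkℚ (ℤ.+ suc m)) (ℚₚ.↥p/↧p≡p (mkℚ (ℤ.+ 1) m (Coprimality.1-coprimeTo (suc m)))))
  (ℚₚ.*-inverseʳ (mkℚ (ℤ.+ suc m) 0 (Coprimality.sym (Coprimality.1-coprimeTo (suc m)))))

inv≡inv! : ∀ n → inv (ℕ→ℚ (n !)) ≡ inv! n
inv≡inv! n = inv-unique (ℕ→ℚ (n !)) (inv! n) (ℕ→ℚ-*-1/ (n !) {{n ℕₚ.!≢0}})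

nCk*[k!*[n∸k]!]≡n! : ∀ {n k} → k ≤ n → (n C k) ℕ.* (k ! ℕ.* (n ∸ k) !) ≡ n !
nCk*[k!*[n∸k]!]≡n! {n} {k} k≤n = trans (cong (ℕ._* (k ! ℕ.* (n ∸ k) !)) (ℕC.nCk≡n!/k![n-k]! k≤n))
  (ℕ.m/n*n≡m {{k ℕₚ.!* (n ∸ k) !≢0}} (ℕC.k![n∸k]!∣n! k≤n))

inv!*inv!≡nCk*inv! : ∀ {n k} → k ≤ n → inv! k * inv! (n ∸ k) ≡ ℕ→ℚ (n C k) * inv! n
inv!*inv!≡nCk*inv! {n} {k} k≤n = begin
  inv! k * inv! (n ∸ k)  ≡⟨ sym (cong₂ _*_ (inv≡inv! k) (inv≡inv! (n ∸ k))) ⟩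
  inv K * inv M          ≡⟨ sym (inv-* K M) ⟩
  inv (K * M)            ≡⟨ inv-unique (K * M) (ℕ→ℚ (n C k) * inv! n) inverse ⟩
  ℕ→ℚ (n C k) * inv! n   ∎
  where
  open ≡-Reasoning
  K M : ℚ
  K = ℕ→ℚ (k !)
  M = ℕ→ℚ ((n ∸ k) !)
  inverse : (K * M) * (ℕ→ℚ (n C k) * inv! n) ≡ 1ℚ
  inverse = begin
    (K * M) * (ℕ→ℚ (n C k) * inv! n)  ≡⟨ solve 4 (λ a b c i → (a :* b) :* (c :* i) := (c :* (a :* b)) :* i)
                                              refl K M (ℕ→ℚ (n C k)) (inv! n) ⟩
    (ℕ→ℚ (n C k) * (K * M)) * inv! n
      ≡⟨ cong (_* inv! n) (sym (trans (ℕ→ℚ-* (n C k) _) (cong (ℕ→ℚ (n C k) *_) (ℕ→ℚ-* (k !) ((n ∸ k) !))))) ⟩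
    ℕ→ℚ ((n C k) ℕ.* (k ! ℕ.* (n ∸ k) !)) * inv! n ≡⟨ cong (λ m → ℕ→ℚ m * inv! n) (nCk*[k!*[n∸k]!]≡n! k≤n) ⟩
    ℕ→ℚ (n !) * inv! n                ≡⟨ ℕ→ℚ-*-1/ (n !) {{n ℕₚ.!≢0}} ⟩
    1ℚ                                ∎

-- Bernoulli numbers and the series x / (eˣ − 1)

tabulate-∷ʳ : ∀ {A : Set} m (f : ℕ → A) →
              Vec.tabulate {n = suc m} (f ∘ toℕ) ≡ Vec.tabulate {n = m} (f ∘ toℕ) ∷ʳ f m
tabulate-∷ʳ zero    f = refl
tabulate-∷ʳ (suc m) f = cong (f 0 Vec.∷_) (tabulate-∷ʳ m (f ∘ suc))

bernVec≡tabulate : ∀ n → bernVec n ≡ Vec.tabulate {n = suc n} (B ∘ toℕ)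
bernVec≡tabulate zero    = refl
bernVec≡tabulate (suc n) = begin
  bernVec n ∷ʳ _                             ≡⟨ cong (bernVec n ∷ʳ_) (sym (Vecₚ.last-∷ʳ _ (bernVec n))) ⟩
  bernVec n ∷ʳ B (suc n)                     ≡⟨ cong (_∷ʳ B (suc n)) (bernVec≡tabulate n) ⟩
  Vec.tabulate (B ∘ toℕ) ∷ʳ B (suc n)        ≡⟨ sym (tabulate-∷ʳ (suc n) B) ⟩
  Vec.tabulate (B ∘ toℕ)                     ∎
  where open ≡-Reasoning

Σℚ-zipWith-tabulate : ∀ m (g : ℚ → ℕ → ℚ) (f : ℕ → ℚ) (h : ℕ → ℕ) →
  Σℚ (Vec.toList (Vec.zipWith g (Vec.tabulate {n = m} (f ∘ toℕ)) (Vec.tabulate (h ∘ toℕ)))) ≡ ∑ m (λ k → g (f k) (h k))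
Σℚ-zipWith-tabulate zero    g f h = refl
Σℚ-zipWith-tabulate (suc m) g f h = cong (g (f 0) (h 0) +_) (Σℚ-zipWith-tabulate m g (f ∘ suc) (h ∘ suc))

B-suc : ∀ n → B (suc n) ≡ - ((ℤ.+ 1 ℚ./ suc (suc n)) * ∑ (suc n) (λ k → ℕ→ℚ (suc (suc n) C k) * B k))
B-suc n = begin
  Vec.last (bernVec n ∷ʳ _)                                                    ≡⟨ Vecₚ.last-∷ʳ _ (bernVec n) ⟩
  - (1/N * Σℚ (Vec.toList (Vec.zipWith summand (bernVec n) (Vec.tabulate toℕ))))
    ≡⟨ cong (λ v → - (1/N * Σℚ (Vec.toList (Vec.zipWith summand v (Vec.tabulate toℕ))))) (bernVec≡tabulate n) ⟩
  - (1/N * Σℚ (Vec.toList (Vec.zipWith summand (Vec.tabulate {n = suc n} (B ∘ toℕ)) (Vec.tabulate toℕ))))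
    ≡⟨ cong (λ s → - (1/N * s)) (Σℚ-zipWith-tabulate (suc n) summand B id) ⟩
  - (1/N * ∑ (suc n) (λ k → ℕ→ℚ (suc (suc n) C k) * B k))                     ∎
  where
  open ≡-Reasoning
  1/N : ℚ
  1/N = ℤ.+ 1 ℚ./ suc (suc n)
  summand : ℚ → ℕ → ℚ
  summand b k = ℕ→ℚ (suc (suc n) C k) * b

bernoulli-recurrence : ∀ n → ∑ (suc (suc n)) (λ k → ℕ→ℚ (suc (suc n) C k) * B k) ≡ 0ℚ
bernoulli-recurrence n = begin
  ∑ N (λ k → ℕ→ℚ (N C k) * B k)             ≡⟨ ∑-last (suc n) (λ k → ℕ→ℚ (N C k) * B k) ⟩
  S + ℕ→ℚ (N C suc n) * B (suc n)           ≡⟨ cong (λ c → S + ℕ→ℚ c * B (suc n)) NC[N-1]≡N ⟩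
  S + ℕ→ℚ N * B (suc n)                     ≡⟨ cong (λ b → S + ℕ→ℚ N * b) (B-suc n) ⟩
  S + ℕ→ℚ N * - (1/N * S)                   ≡⟨ solve 3 (λ s a i → s :+ a :* (:- (i :* s)) := s :+ :- ((a :* i) :* s))
                                                   refl S (ℕ→ℚ N) 1/N ⟩
  S + - ((ℕ→ℚ N * 1/N) * S)                 ≡⟨ cong (λ x → S + - (x * S)) (ℕ→ℚ-*-1/ N) ⟩
  S + - (1ℚ * S)                            ≡⟨ solve 1 (λ s → s :+ :- (con 1ℚ :* s) := con 0ℚ) refl S ⟩
  0ℚ                                        ∎
  where
  open ≡-Reasoning
  N : ℕ
  N = suc (suc n)
  1/N : ℚ
  1/N = ℤ.+ 1 ℚ./ N
  S : ℚ
  S = ∑ (suc n) (λ k → ℕ→ℚ (N C k) * B k)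
  NC[N-1]≡N : N C suc n ≡ N
  NC[N-1]≡N = trans (ℕC.nCk≡nC[n∸k] (ℕₚ.n≤1+n (suc n))) (trans (cong (N C_) (ℕₚ.m+n∸n≡m 1 n)) (ℕC.nC1≡n N))

exp : Series
exp = inv!

expm1 : Series
expm1 zero    = 0ℚ
expm1 (suc k) = inv! (suc k)

bernoulliSeries : Series
bernoulliSeries k = B k * inv! k

bernoulliSeries-∗-expm1 : bernoulliSeries ∗ expm1 ≗ δ₁
bernoulliSeries-∗-expm1 zero          = refl
bernoulliSeries-∗-expm1 (suc zero)    = refl
bernoulliSeries-∗-expm1 (suc (suc n)) = begin
  ∑ (suc N) (λ k → bernoulliSeries k * expm1 (N ∸ k))
    ≡⟨ ∑-last N (λ k → bernoulliSeries k * expm1 (N ∸ k)) ⟩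
  ∑ N (λ k → bernoulliSeries k * expm1 (N ∸ k)) + bernoulliSeries N * expm1 (N ∸ N)
    ≡⟨ cong₂ _+_ (∑-cong-< N term)
                 (trans (cong (λ m → bernoulliSeries N * expm1 m) (ℕₚ.n∸n≡0 N)) (ℚₚ.*-zeroʳ (bernoulliSeries N))) ⟩
  ∑ N (λ k → inv! N * (ℕ→ℚ (N C k) * B k)) + 0ℚ
    ≡⟨ trans (ℚₚ.+-identityʳ _) (∑-*ˡ N (inv! N) (λ k → ℕ→ℚ (N C k) * B k)) ⟩
  inv! N * ∑ N (λ k → ℕ→ℚ (N C k) * B k)
    ≡⟨ trans (cong (inv! N *_) (bernoulli-recurrence n)) (ℚₚ.*-zeroʳ (inv! N)) ⟩
  0ℚ ∎
  where
  open ≡-Reasoning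
  N : ℕ
  N = suc (suc n)
  expm1-pos : ∀ m → 0 < m → expm1 m ≡ inv! m
  expm1-pos (suc m) _ = refl
  term : ∀ k → k < N → bernoulliSeries k * expm1 (N ∸ k) ≡ inv! N * (ℕ→ℚ (N C k) * B k)
  term k k<N = begin
    B k * inv! k * expm1 (N ∸ k)  ≡⟨ cong (B k * inv! k *_) (expm1-pos (N ∸ k) (ℕₚ.m<n⇒0<n∸m k<N)) ⟩
    B k * inv! k * inv! (N ∸ k)   ≡⟨ ℚₚ.*-assoc (B k) (inv! k) (inv! (N ∸ k)) ⟩
    B k * (inv! k * inv! (N ∸ k)) ≡⟨ cong (B k *_) (inv!*inv!≡nCk*inv! (ℕₚ.<⇒≤ k<N)) ⟩
    B k * (ℕ→ℚ (N C k) * inv! N)  ≡⟨ solve 3 (λ b c i → b :* (c :* i) := i :* (c :* b)) refl (B k) (ℕ→ℚ (N C k)) (inv! N) ⟩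
    inv! N * (ℕ→ℚ (N C k) * B k)  ∎

alternating-binomial-sum : ∀ n → ∑ (suc n) (λ k → sgn k * ℕ→ℚ (n C k)) ≡ δ₀ n
alternating-binomial-sum zero    = refl
alternating-binomial-sum (suc n) = begin
  1ℚ + ∑ (suc n) (λ k → sgn (suc k) * ℕ→ℚ (suc n C suc k))  ≡⟨ cong (1ℚ +_) (∑-cong (suc n) pascal) ⟩
  1ℚ + ∑ (suc n) (λ k → - a k + a (suc k))                  ≡⟨ cong (1ℚ +_) (trans (∑-+ (suc n) (λ k → - a k) (a ∘ suc))
                                                                                   (cong (_+ T) (∑-neg (suc n) a))) ⟩
  1ℚ + (- A + T)
    ≡⟨ solve 2 (λ x t → con 1ℚ :+ (:- x :+ t) := (con 1ℚ :+ t) :+ :- x) refl A T ⟩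
  ∑ (suc (suc n)) a + - A                                   ≡⟨ cong (_+ - A) (∑-last (suc n) a) ⟩
  (A + sgn (suc n) * ℕ→ℚ (n C suc n)) + - A
    ≡⟨ cong (λ c → (A + sgn (suc n) * ℕ→ℚ c) + - A) (ℕC.k>n⇒nCk≡0 (ℕₚ.n<1+n n)) ⟩
  (A + sgn (suc n) * 0ℚ) + - A
    ≡⟨ solve 2 (λ x s → (x :+ s :* con 0ℚ) :+ :- x := con 0ℚ) refl A (sgn (suc n)) ⟩
  0ℚ                                                        ∎
  where
  open ≡-Reasoning
  a : ℕ → ℚ
  a k = sgn k * ℕ→ℚ (n C k)
  A T : ℚ
  A = ∑ (suc n) a
  T = ∑ (suc n) (a ∘ suc)
  pascal : ∀ k → sgn (suc k) * ℕ→ℚ (suc n C suc k) ≡ - a k + a (suc k)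
  pascal k = begin
    sgn (suc k) * ℕ→ℚ (suc n C suc k)
      ≡⟨ cong (λ c → sgn (suc k) * ℕ→ℚ c) (sym (ℕC.nCk+nC[k+1]≡[n+1]C[k+1] n k)) ⟩
    sgn (suc k) * ℕ→ℚ (n C k ℕ.+ n C suc k)          ≡⟨ cong (sgn (suc k) *_) (ℕ→ℚ-+ (n C k) (n C suc k)) ⟩
    (- 1ℚ * sgn k) * (ℕ→ℚ (n C k) + ℕ→ℚ (n C suc k)) ≡⟨ solve 3 (λ s x y → (:- con 1ℚ :* s) :* (x :+ y) := :- (s :* x) :+ (:- con 1ℚ :* s) :* y)
                                                          refl (sgn k) (ℕ→ℚ (n C k)) (ℕ→ℚ (n C suc k)) ⟩
    - a k + a (suc k)                                ∎

alternate-exp-∗-exp : alternate exp ∗ exp ≗ δ₀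
alternate-exp-∗-exp n = begin
  ∑ (suc n) (λ k → (sgn k * inv! k) * inv! (n ∸ k))  ≡⟨ ∑-cong-< (suc n) term ⟩
  ∑ (suc n) (λ k → inv! n * (sgn k * ℕ→ℚ (n C k)))   ≡⟨ ∑-*ˡ (suc n) (inv! n) (λ k → sgn k * ℕ→ℚ (n C k)) ⟩
  inv! n * ∑ (suc n) (λ k → sgn k * ℕ→ℚ (n C k))     ≡⟨ cong (inv! n *_) (alternating-binomial-sum n) ⟩
  inv! n * δ₀ n                                      ≡⟨ inv!*δ₀ n ⟩
  δ₀ n                                               ∎
  where
  open ≡-Reasoning
  term : ∀ k → k < suc n → (sgn k * inv! k) * inv! (n ∸ k) ≡ inv! n * (sgn k * ℕ→ℚ (n C k))
  term k (s≤s k≤n) = begin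
    (sgn k * inv! k) * inv! (n ∸ k)  ≡⟨ ℚₚ.*-assoc (sgn k) (inv! k) (inv! (n ∸ k)) ⟩
    sgn k * (inv! k * inv! (n ∸ k))  ≡⟨ cong (sgn k *_) (inv!*inv!≡nCk*inv! k≤n) ⟩
    sgn k * (ℕ→ℚ (n C k) * inv! n)   ≡⟨ solve 3 (λ s c i → s :* (c :* i) := i :* (s :* c)) refl (sgn k) (ℕ→ℚ (n C k)) (inv! n) ⟩
    inv! n * (sgn k * ℕ→ℚ (n C k))   ∎
  inv!*δ₀ : ∀ n → inv! n * δ₀ n ≡ δ₀ n
  inv!*δ₀ zero    = refl
  inv!*δ₀ (suc n) = ℚₚ.*-zeroʳ (inv! (suc n))

alternate-δ₁ : ∀ n → sgn n * δ₁ n ≡ - δ₁ n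
alternate-δ₁ zero          = refl
alternate-δ₁ (suc zero)    = refl
alternate-δ₁ (suc (suc n)) = ℚₚ.*-zeroʳ (sgn (suc (suc n)))

expm1≡-exp∗alternate-expm1 : ∀ n → expm1 n ≡ - (exp ∗ alternate expm1) n
expm1≡-exp∗alternate-expm1 n = sym (begin
  - (exp ∗ alternate expm1) n                          ≡⟨ cong -_ (∗-congʳ exp alternate-expm1 n) ⟩
  - (exp ∗ (alternate exp ⊕ (λ k → - δ₀ k))) n         ≡⟨ cong -_ (∗-distribˡ-⊕ exp (alternate exp) (λ k → - δ₀ k) n) ⟩
  - ((exp ∗ alternate exp) n + (exp ∗ (λ k → - δ₀ k)) n)
    ≡⟨ cong₂ (λ x y → - (x + y)) (trans (∗-comm exp (alternate exp) n) (alternate-exp-∗-exp n))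
                                 (trans (∗-negʳ exp δ₀ n) (cong -_ (∗-identityʳ exp n))) ⟩
  - (δ₀ n + - exp n)                                   ≡⟨ cancel n ⟩
  expm1 n                                              ∎)
  where
  open ≡-Reasoning
  alternate-expm1 : alternate expm1 ≗ alternate exp ⊕ (λ k → - δ₀ k)
  alternate-expm1 zero    = refl
  alternate-expm1 (suc k) = sym (ℚₚ.+-identityʳ (alternate exp (suc k)))
  cancel : ∀ n → - (δ₀ n + - exp n) ≡ expm1 n
  cancel zero    = refl
  cancel (suc n) = solve 1 (λ x → :- (con 0ℚ :+ :- x) := x) refl (inv! (suc n))

alternate-bernoulliSeries-∗-expm1 : alternate bernoulliSeries ∗ expm1 ≗ shift exp
alternate-bernoulliSeries-∗-expm1 n = begin
  (β̃ ∗ expm1) n                                ≡⟨ ∗-congʳ β̃ expm1≡-exp∗alternate-expm1 n ⟩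
  (β̃ ∗ (λ m → - (exp ∗ alternate expm1) m)) n  ≡⟨ ∗-negʳ β̃ (exp ∗ alternate expm1) n ⟩
  - (β̃ ∗ (exp ∗ alternate expm1)) n            ≡⟨ cong -_ (∗-swap β̃ exp (alternate expm1) n) ⟩
  - (exp ∗ (β̃ ∗ alternate expm1)) n            ≡⟨ cong -_ (∗-congʳ exp reflected n) ⟩
  - (exp ∗ (λ m → - δ₁ m)) n                   ≡⟨ cong -_ (∗-negʳ exp δ₁ n) ⟩
  - - (exp ∗ δ₁) n                             ≡⟨ solve 1 (λ x → :- (:- x) := x) refl ((exp ∗ δ₁) n) ⟩
  (exp ∗ δ₁) n                                 ≡⟨ ∗-comm exp δ₁ n ⟩
  (δ₁ ∗ exp) n                                 ≡⟨ δ₁-∗ exp n ⟩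
  shift exp n                                  ∎
  where
  open ≡-Reasoning
  β̃ : Series
  β̃ = alternate bernoulliSeries
  reflected : ∀ m → (β̃ ∗ alternate expm1) m ≡ - δ₁ m
  reflected m = trans (sym (alternate-∗ bernoulliSeries expm1 m))
                      (trans (cong (sgn m *_) (bernoulliSeries-∗-expm1 m)) (alternate-δ₁ m))

bernoulliSeries-unique : ∀ f → f ∗ expm1 ≗ δ₁ → f ≗ bernoulliSeries
bernoulliSeries-unique f f∗expm1≗δ₁ k = begin
  f k                                          ≡⟨ sym (δ₁-∗ f (suc k)) ⟩
  (δ₁ ∗ f) (suc k)                             ≡⟨ ∗-comm δ₁ f (suc k) ⟩
  (f ∗ δ₁) (suc k)                             ≡⟨ ∗-congʳ f (λ m → sym (bernoulliSeries-∗-expm1 m)) (suc k) ⟩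
  (f ∗ (bernoulliSeries ∗ expm1)) (suc k)      ≡⟨ ∗-swap f bernoulliSeries expm1 (suc k) ⟩
  (bernoulliSeries ∗ (f ∗ expm1)) (suc k)      ≡⟨ ∗-congʳ bernoulliSeries f∗expm1≗δ₁ (suc k) ⟩
  (bernoulliSeries ∗ δ₁) (suc k)               ≡⟨ ∗-comm bernoulliSeries δ₁ (suc k) ⟩
  (δ₁ ∗ bernoulliSeries) (suc k)               ≡⟨ δ₁-∗ bernoulliSeries (suc k) ⟩
  bernoulliSeries k                            ∎
  where open ≡-Reasoning

alternate-bernoulliSeries : alternate bernoulliSeries ≗ bernoulliSeries ⊕ δ₁
alternate-bernoulliSeries k = begin
  sgn k * bernoulliSeries k  ≡⟨ solve 2 (λ x d → x := (x :+ :- d) :+ d) refl (sgn k * bernoulliSeries k) (δ₁ k) ⟩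
  f k + δ₁ k                 ≡⟨ cong (_+ δ₁ k) (bernoulliSeries-unique f f∗expm1≗δ₁ k) ⟩
  bernoulliSeries k + δ₁ k   ∎
  where
  open ≡-Reasoning
  f : Series
  f = alternate bernoulliSeries ⊕ (λ m → - δ₁ m)
  shift-exp-expm1 : ∀ n → shift exp n + - shift expm1 n ≡ δ₁ n
  shift-exp-expm1 zero          = refl
  shift-exp-expm1 (suc zero)    = refl
  shift-exp-expm1 (suc (suc n)) = ℚₚ.+-inverseʳ (inv! (suc n))
  f∗expm1≗δ₁ : f ∗ expm1 ≗ δ₁
  f∗expm1≗δ₁ n = begin
    (f ∗ expm1) n                                                       ≡⟨ ∗-distribʳ-⊕ (alternate bernoulliSeries) (λ m → - δ₁ m) expm1 n ⟩
    (alternate bernoulliSeries ∗ expm1) n + ((λ m → - δ₁ m) ∗ expm1) n  ≡⟨ cong₂ _+_ (alternate-bernoulliSeries-∗-expm1 n)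
                                                                              (trans (∗-negˡ δ₁ expm1 n) (cong -_ (δ₁-∗ expm1 n))) ⟩
    shift exp n + - shift expm1 n                                       ≡⟨ shift-exp-expm1 n ⟩
    δ₁ n                                                                ∎

-- The polynomial part and the sign of one parameter

mono-+ : ∀ a b n j → mono (a + b) n j ≡ mono a n j + mono b n j
mono-+ a b n j with j ≡ᵇ n
... | true  = refl
... | false = refl

mono-* : ∀ c a n j → mono (c * a) n j ≡ c * mono a n j
mono-* c a n j with j ≡ᵇ n
... | true  = refl
... | false = sym (ℚₚ.*-zeroʳ c)

mono-neg : ∀ a n j → mono (- a) n j ≡ - mono a n j
mono-neg a n j with j ≡ᵇ n
... | true  = refl
... | false = refl

mono-zero : ∀ n j → mono 0ℚ n j ≡ 0ℚ
mono-zero n j with j ≡ᵇ n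
... | true  = refl
... | false = refl

unscaledTerm : ℕ → Series → ℕ → Poly
unscaledTerm d h m = mono (sgn m * inv! (d ∸ 1 ∸ m) * h m) (d ∸ 1 ∸ m)

unscaledPoly : ℕ → Series → Poly
unscaledPoly d h j = ∑ d (λ m → unscaledTerm d h m j)

poly≡inv*unscaledPoly : ∀ cs j → poly cs j ≡ inv (Πℚ (map ℤ→ℚ cs)) * unscaledPoly (length cs) (innerSum cs) j
poly≡inv*unscaledPoly cs j = cong (inv (Πℚ (map ℤ→ℚ cs)) *_)
  (trans (ΣP-apply (unscaledTerm d (innerSum cs)) (upTo d) j) (Σ<≡∑ d (λ m → unscaledTerm d (innerSum cs) m j)))
  where d = length cs

poly-[] : ∀ j → poly [] j ≡ 0ℚ
poly-[] j = ℚₚ.*-zeroʳ (inv 1ℚ)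

unscaledPoly-cong : ∀ d {h h′} → h ≗ h′ → ∀ j → unscaledPoly d h j ≡ unscaledPoly d h′ j
unscaledPoly-cong d eq j = ∑-cong d (λ m → cong (λ x → mono (sgn m * inv! (d ∸ 1 ∸ m) * x) (d ∸ 1 ∸ m) j) (eq m))

unscaledPoly-⊕ : ∀ d h h′ j → unscaledPoly d (h ⊕ h′) j ≡ unscaledPoly d h j + unscaledPoly d h′ j
unscaledPoly-⊕ d h h′ j = trans (∑-cong d term) (∑-+ d (λ m → unscaledTerm d h m j) (λ m → unscaledTerm d h′ m j))
  where
  term : ∀ m → unscaledTerm d (h ⊕ h′) m j ≡ unscaledTerm d h m j + unscaledTerm d h′ m j
  term m = trans (cong (λ x → mono x (d ∸ 1 ∸ m) j) (ℚₚ.*-distribˡ-+ (sgn m * inv! (d ∸ 1 ∸ m)) (h m) (h′ m)))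
                 (mono-+ _ _ (d ∸ 1 ∸ m) j)

unscaledPoly-⊙ : ∀ d c h j → unscaledPoly d (c ⊙ h) j ≡ c * unscaledPoly d h j
unscaledPoly-⊙ d c h j = trans (∑-cong d term) (∑-*ˡ d c (λ m → unscaledTerm d h m j))
  where
  term : ∀ m → unscaledTerm d (c ⊙ h) m j ≡ c * unscaledTerm d h m j
  term m = trans (cong (λ x → mono x (d ∸ 1 ∸ m) j)
                       (solve 3 (λ x y z → x :* (y :* z) := y :* (x :* z)) refl (sgn m * inv! (d ∸ 1 ∸ m)) c (h m)))
                 (mono-* c _ (d ∸ 1 ∸ m) j)

-- Multiplying the inner sums by x lowers the degree d − 1 − m by one and flips (−1)^m.
unscaledPoly-shift : ∀ d h j → unscaledPoly (suc d) (shift h) j ≡ - unscaledPoly d h j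
unscaledPoly-shift d h j = begin
  mono (sgn 0 * inv! d * 0ℚ) d j + ∑ d (λ m → unscaledTerm (suc d) (shift h) (suc m) j)
    ≡⟨ cong₂ _+_ (trans (cong (λ x → mono x d j) (ℚₚ.*-zeroʳ (sgn 0 * inv! d))) (mono-zero d j)) (∑-cong d term) ⟩
  0ℚ + ∑ d (λ m → - unscaledTerm d h m j)
    ≡⟨ trans (ℚₚ.+-identityˡ _) (∑-neg d (λ m → unscaledTerm d h m j)) ⟩
  - unscaledPoly d h j ∎
  where
  open ≡-Reasoning
  term : ∀ m → unscaledTerm (suc d) (shift h) (suc m) j ≡ - unscaledTerm d h m j
  term m rewrite ℕₚ.∸-+-assoc d 1 m =
    trans (cong (λ x → mono x (d ∸ suc m) j)
                (solve 3 (λ s i x → (:- con 1ℚ :* s) :* i :* x := :- (s :* i :* x)) refl (sgn m) (inv! (d ∸ suc m)) (h m)))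
          (mono-neg _ (d ∸ suc m) j)

scaledBernoulli : ℤ → Series
scaledBernoulli c k = (ℤ→ℚ c ^ k) * B k * inv! k

innerSum-∷ : ∀ c cs → innerSum (c ∷ cs) ≗ scaledBernoulli c ∗ innerSum cs
innerSum-∷ c cs m = begin
  Σℚ (map F (concatMap (λ k → map (k Vec.∷_) (compositions d (m ∸ k))) (upTo (suc m))))
    ≡⟨ Σℚ-concatMap F (λ k → map (k Vec.∷_) (compositions d (m ∸ k))) (upTo (suc m)) ⟩
  Σℚ (map (λ k → Σℚ (map F (map (k Vec.∷_) (compositions d (m ∸ k))))) (upTo (suc m)))
    ≡⟨ Σℚ-map-cong (upTo (suc m)) (λ k → trans (cong Σℚ (sym (Listₚ.map-∘ (compositions d (m ∸ k)))))
                                               (Σℚ-map-*ˡ (scaledBernoulli c k) F′ (compositions d (m ∸ k)))) ⟩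
  (Σ< suc m) (λ k → scaledBernoulli c k * innerSum cs (m ∸ k))
    ≡⟨ Σ<≡∑ (suc m) (λ k → scaledBernoulli c k * innerSum cs (m ∸ k)) ⟩
  (scaledBernoulli c ∗ innerSum cs) m ∎
  where
  open ≡-Reasoning
  d : ℕ
  d = length cs
  F : Vec ℕ (suc d) → ℚ
  F ks = Πℚ (Vec.toList (Vec.zipWith scaledBernoulli (Vec.fromList (c ∷ cs)) ks))
  F′ : Vec ℕ d → ℚ
  F′ ks = Πℚ (Vec.toList (Vec.zipWith scaledBernoulli (Vec.fromList cs) ks))

innerSum-move : ∀ ps c cs → innerSum (ps ++ c ∷ cs) ≗ innerSum (c ∷ ps ++ cs)
innerSum-move []       c cs m = refl
innerSum-move (p ∷ ps) c cs m = begin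
  innerSum (p ∷ ps ++ c ∷ cs) m                   ≡⟨ innerSum-∷ p (ps ++ c ∷ cs) m ⟩
  (β p ∗ innerSum (ps ++ c ∷ cs)) m               ≡⟨ ∗-congʳ (β p) (λ k → trans (innerSum-move ps c cs k) (innerSum-∷ c (ps ++ cs) k)) m ⟩
  (β p ∗ (β c ∗ innerSum (ps ++ cs))) m           ≡⟨ ∗-swap (β p) (β c) (innerSum (ps ++ cs)) m ⟩
  (β c ∗ (β p ∗ innerSum (ps ++ cs))) m           ≡⟨ ∗-congʳ (β c) (λ k → sym (innerSum-∷ p (ps ++ cs) k)) m ⟩
  (β c ∗ innerSum (p ∷ ps ++ cs)) m               ≡⟨ sym (innerSum-∷ c (p ∷ ps ++ cs) m) ⟩
  innerSum (c ∷ p ∷ ps ++ cs) m                   ∎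
  where
  open ≡-Reasoning
  β : ℤ → Series
  β = scaledBernoulli

Πℚ-move : ∀ ps c cs → Πℚ (map ℤ→ℚ (ps ++ c ∷ cs)) ≡ ℤ→ℚ c * Πℚ (map ℤ→ℚ (ps ++ cs))
Πℚ-move []       c cs = refl
Πℚ-move (p ∷ ps) c cs = trans (cong (ℤ→ℚ p *_) (Πℚ-move ps c cs))
  (solve 3 (λ a b x → a :* (b :* x) := b :* (a :* x)) refl (ℤ→ℚ p) (ℤ→ℚ c) (Πℚ (map ℤ→ℚ (ps ++ cs))))

poly-move : ∀ ps c cs j → poly (ps ++ c ∷ cs) j ≡ poly (c ∷ ps ++ cs) j
poly-move ps c cs j = begin
  poly (ps ++ c ∷ cs) j
    ≡⟨ poly≡inv*unscaledPoly (ps ++ c ∷ cs) j ⟩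
  inv (Πℚ (map ℤ→ℚ (ps ++ c ∷ cs))) * unscaledPoly (length (ps ++ c ∷ cs)) (innerSum (ps ++ c ∷ cs)) j
    ≡⟨ cong₂ (λ p d → inv p * unscaledPoly d (innerSum (ps ++ c ∷ cs)) j) (Πℚ-move ps c cs) (Listₚ.length-++-sucʳ ps c cs) ⟩
  inv (ℤ→ℚ c * Πℚ (map ℤ→ℚ (ps ++ cs))) * unscaledPoly (suc (length (ps ++ cs))) (innerSum (ps ++ c ∷ cs)) j
    ≡⟨ cong (inv (ℤ→ℚ c * Πℚ (map ℤ→ℚ (ps ++ cs))) *_) (unscaledPoly-cong (suc (length (ps ++ cs))) (innerSum-move ps c cs) j) ⟩
  inv (ℤ→ℚ c * Πℚ (map ℤ→ℚ (ps ++ cs))) * unscaledPoly (suc (length (ps ++ cs))) (innerSum (c ∷ ps ++ cs)) j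
    ≡⟨ sym (poly≡inv*unscaledPoly (c ∷ ps ++ cs) j) ⟩
  poly (c ∷ ps ++ cs) j ∎
  where open ≡-Reasoning

^-neg : ∀ x k → (- x) ^ k ≡ sgn k * x ^ k
^-neg x zero    = refl
^-neg x (suc k) = trans (cong ((- x) *_) (^-neg x k))
  (solve 3 (λ a s p → (:- a) :* (s :* p) := (:- con 1ℚ :* s) :* (a :* p)) refl x (sgn k) (x ^ k))

^-*δ₁ : ∀ x k → x ^ k * δ₁ k ≡ x * δ₁ k
^-*δ₁ x zero          = trans (ℚₚ.*-zeroʳ 1ℚ) (sym (ℚₚ.*-zeroʳ x))
^-*δ₁ x (suc zero)    = solve 1 (λ a → (a :* con 1ℚ) :* con 1ℚ := a :* con 1ℚ) refl x
^-*δ₁ x (suc (suc k)) = trans (ℚₚ.*-zeroʳ (x ^ suc (suc k))) (sym (ℚₚ.*-zeroʳ x))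

scaledBernoulli-neg : ∀ c → scaledBernoulli (ℤ.- c) ≗ scaledBernoulli c ⊕ (ℤ→ℚ c ⊙ δ₁)
scaledBernoulli-neg c k = begin
  (ℤ→ℚ (ℤ.- c) ^ k) * B k * inv! k             ≡⟨ cong (λ y → (y ^ k) * B k * inv! k) (ℤ→ℚ-neg c) ⟩
  ((- x) ^ k) * B k * inv! k                   ≡⟨ cong (λ y → y * B k * inv! k) (^-neg x k) ⟩
  (sgn k * x ^ k) * B k * inv! k               ≡⟨ solve 4 (λ s p b i → s :* p :* b :* i := p :* (s :* (b :* i)))
                                                     refl (sgn k) (x ^ k) (B k) (inv! k) ⟩
  x ^ k * (sgn k * bernoulliSeries k)          ≡⟨ cong (x ^ k *_) (alternate-bernoulliSeries k) ⟩
  x ^ k * (bernoulliSeries k + δ₁ k)           ≡⟨ ℚₚ.*-distribˡ-+ (x ^ k) (bernoulliSeries k) (δ₁ k) ⟩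
  x ^ k * bernoulliSeries k + x ^ k * δ₁ k     ≡⟨ cong₂ _+_ (sym (ℚₚ.*-assoc (x ^ k) (B k) (inv! k))) (^-*δ₁ x k) ⟩
  (x ^ k) * B k * inv! k + x * δ₁ k            ∎
  where
  open ≡-Reasoning
  x : ℚ
  x = ℤ→ℚ c

innerSum-neg : ∀ c cs → innerSum (ℤ.- c ∷ cs) ≗ innerSum (c ∷ cs) ⊕ (ℤ→ℚ c ⊙ shift (innerSum cs))
innerSum-neg c cs m = begin
  innerSum (ℤ.- c ∷ cs) m                                       ≡⟨ innerSum-∷ (ℤ.- c) cs m ⟩
  (scaledBernoulli (ℤ.- c) ∗ innerSum cs) m                     ≡⟨ ∗-congˡ (innerSum cs) (scaledBernoulli-neg c) m ⟩
  ((scaledBernoulli c ⊕ (ℤ→ℚ c ⊙ δ₁)) ∗ innerSum cs) m          ≡⟨ ∗-distribʳ-⊕ (scaledBernoulli c) (ℤ→ℚ c ⊙ δ₁) (innerSum cs) m ⟩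
  (scaledBernoulli c ∗ innerSum cs) m + ((ℤ→ℚ c ⊙ δ₁) ∗ innerSum cs) m
    ≡⟨ cong₂ _+_ (sym (innerSum-∷ c cs m))
                 (trans (∗-⊙ˡ (ℤ→ℚ c) δ₁ (innerSum cs) m) (cong (ℤ→ℚ c *_) (δ₁-∗ (innerSum cs) m))) ⟩
  innerSum (c ∷ cs) m + ℤ→ℚ c * shift (innerSum cs) m           ∎
  where open ≡-Reasoning

poly-neg-∷ : ∀ c cs → ℤ→ℚ c ≢ 0ℚ → ∀ j → poly (ℤ.- c ∷ cs) j ≡ poly cs j + - poly (c ∷ cs) j
poly-neg-∷ c cs c≢0 j = begin
  poly (ℤ.- c ∷ cs) j
    ≡⟨ poly≡inv*unscaledPoly (ℤ.- c ∷ cs) j ⟩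
  inv (ℤ→ℚ (ℤ.- c) * P) * unscaledPoly (suc d) (innerSum (ℤ.- c ∷ cs)) j
    ≡⟨ cong₂ _*_ (cong (λ y → inv (y * P)) (ℤ→ℚ-neg c)) (unscaledPoly-cong (suc d) (innerSum-neg c cs) j) ⟩
  inv (- x * P) * unscaledPoly (suc d) (innerSum (c ∷ cs) ⊕ (x ⊙ shift (innerSum cs))) j
    ≡⟨ cong₂ _*_ (trans (inv-* (- x) P) (cong (_* inv P) (inv-neg x))) unscaled ⟩
  (- inv x * inv P) * (U + x * - V)
    ≡⟨ solve 5 (λ ix iP u a v → (:- ix :* iP) :* (u :+ a :* (:- v)) := (a :* ix) :* (iP :* v) :+ (:- (ix :* iP :* u)))
         refl (inv x) (inv P) U x V ⟩
  (x * inv x) * (inv P * V) + - (inv x * inv P * U)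
    ≡⟨ cong₂ (λ y z → y * (inv P * V) + - (z * U)) (*-inv x c≢0) (sym (inv-* x P)) ⟩
  1ℚ * (inv P * V) + - (inv (x * P) * U)
    ≡⟨ cong₂ (λ y z → y + - z) (trans (ℚₚ.*-identityˡ _) (sym (poly≡inv*unscaledPoly cs j)))
                               (sym (poly≡inv*unscaledPoly (c ∷ cs) j)) ⟩
  poly cs j + - poly (c ∷ cs) j ∎
  where
  open ≡-Reasoning
  x P : ℚ
  x = ℤ→ℚ c
  P = Πℚ (map ℤ→ℚ cs)
  d : ℕ
  d = length cs
  U V : ℚ
  U = unscaledPoly (suc d) (innerSum (c ∷ cs)) j
  V = unscaledPoly d (innerSum cs) j
  unscaled : unscaledPoly (suc d) (innerSum (c ∷ cs) ⊕ (x ⊙ shift (innerSum cs))) j ≡ U + x * - V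
  unscaled = trans (unscaledPoly-⊕ (suc d) (innerSum (c ∷ cs)) (x ⊙ shift (innerSum cs)) j)
    (cong (U +_) (trans (unscaledPoly-⊙ (suc d) x (shift (innerSum cs)) j) (cong (x *_) (unscaledPoly-shift d (innerSum cs) j))))

poly-neg : ∀ ps c cs → ℤ→ℚ c ≢ 0ℚ → ∀ j → poly (ps ++ ℤ.- c ∷ cs) j ≡ poly (ps ++ cs) j + - poly (ps ++ c ∷ cs) j
poly-neg ps c cs c≢0 j = begin
  poly (ps ++ ℤ.- c ∷ cs) j                    ≡⟨ poly-move ps (ℤ.- c) cs j ⟩
  poly (ℤ.- c ∷ ps ++ cs) j                    ≡⟨ poly-neg-∷ c (ps ++ cs) c≢0 j ⟩
  poly (ps ++ cs) j + - poly (c ∷ ps ++ cs) j  ≡⟨ cong (λ y → poly (ps ++ cs) j + - y) (sym (poly-move ps c cs j)) ⟩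
  poly (ps ++ cs) j + - poly (ps ++ c ∷ cs) j  ∎
  where open ≡-Reasoning

-- Inclusion–exclusion over the negated parameters

length<⇒choose≡[] : ∀ {A : Set} k (xs : List A) → length xs < k → choose k xs ≡ []
length<⇒choose≡[] (suc k)       []       _                   = refl
length<⇒choose≡[] (suc zero)    (x ∷ xs) (s≤s ())
length<⇒choose≡[] (suc (suc k)) (x ∷ xs) (s≤s (s≤s |xs|≤k)) =
  cong₂ _++_ (cong (map (x ∷_)) (length<⇒choose≡[] (suc k) xs (s≤s |xs|≤k)))
             (length<⇒choose≡[] (suc (suc k)) xs (ℕₚ.m<n⇒m<1+n (s≤s |xs|≤k)))

subsetSum : List ℤ → List ℕ → ℕ → Poly
subsetSum ps as k j = Σℚ (map (λ S → poly (ps ++ map ℤ.+_ S) j) (choose k as))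

subsetSum-∷ : ∀ ps a as k j →
  subsetSum ps (a ∷ as) (suc k) j ≡ subsetSum (ps ++ ℤ.+ a ∷ []) as k j + subsetSum ps as (suc k) j
subsetSum-∷ ps a as k j = begin
  Σℚ (map F (map (a ∷_) (choose k as) ++ choose (suc k) as))
    ≡⟨ cong Σℚ (Listₚ.map-++ F (map (a ∷_) (choose k as)) (choose (suc k) as)) ⟩
  Σℚ (map F (map (a ∷_) (choose k as)) ++ map F (choose (suc k) as))
    ≡⟨ Σℚ-++ (map F (map (a ∷_) (choose k as))) (map F (choose (suc k) as)) ⟩
  Σℚ (map F (map (a ∷_) (choose k as))) + subsetSum ps as (suc k) j
    ≡⟨ cong (_+ subsetSum ps as (suc k) j) (trans (cong Σℚ (sym (Listₚ.map-∘ (choose k as))))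
         (Σℚ-map-cong (choose k as) (λ S → cong (λ cs → poly cs j) (sym (Listₚ.++-assoc ps (ℤ.+ a ∷ []) (map ℤ.+_ S)))))) ⟩
  subsetSum (ps ++ ℤ.+ a ∷ []) as k j + subsetSum ps as (suc k) j ∎
  where
  open ≡-Reasoning
  F : List ℕ → ℚ
  F S = poly (ps ++ map ℤ.+_ S) j

inclusionExclusion : List ℤ → List ℕ → Poly
inclusionExclusion ps as j = ∑ (suc (length as)) (λ k → sgn k * subsetSum ps as k j)

inclusionExclusion-∷ : ∀ ps a as j →
  inclusionExclusion ps (a ∷ as) j ≡ inclusionExclusion ps as j + - inclusionExclusion (ps ++ ℤ.+ a ∷ []) as j
inclusionExclusion-∷ ps a as j = begin
  sgn 0 * C 0 + ∑ (suc n) (λ k → sgn (suc k) * subsetSum ps (a ∷ as) (suc k) j)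
    ≡⟨ cong (sgn 0 * C 0 +_) (trans (∑-cong (suc n) term)
         (trans (∑-+ (suc n) (λ k → sgn (suc k) * C (suc k)) (λ k → - (sgn k * C′ k)))
                (cong (∑ (suc n) (λ k → sgn (suc k) * C (suc k)) +_) (∑-neg (suc n) (λ k → sgn k * C′ k))))) ⟩
  sgn 0 * C 0 + (∑ (suc n) (λ k → sgn (suc k) * C (suc k)) + - IE′)
    ≡⟨ sym (ℚₚ.+-assoc (sgn 0 * C 0) _ _) ⟩
  ∑ (suc (suc n)) (λ k → sgn k * C k) + - IE′
    ≡⟨ cong (_+ - IE′) (∑-last (suc n) (λ k → sgn k * C k)) ⟩
  (inclusionExclusion ps as j + sgn (suc n) * C (suc n)) + - IE′
    ≡⟨ cong (λ y → (inclusionExclusion ps as j + y) + - IE′) top-vanishes ⟩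
  (inclusionExclusion ps as j + 0ℚ) + - IE′
    ≡⟨ cong (_+ - IE′) (ℚₚ.+-identityʳ (inclusionExclusion ps as j)) ⟩
  inclusionExclusion ps as j + - IE′ ∎
  where
  open ≡-Reasoning
  n : ℕ
  n = length as
  C C′ : ℕ → ℚ
  C k = subsetSum ps as k j
  C′ k = subsetSum (ps ++ ℤ.+ a ∷ []) as k j
  IE′ : ℚ
  IE′ = inclusionExclusion (ps ++ ℤ.+ a ∷ []) as j
  term : ∀ k → sgn (suc k) * subsetSum ps (a ∷ as) (suc k) j ≡ sgn (suc k) * C (suc k) + - (sgn k * C′ k)
  term k = trans (cong (sgn (suc k) *_) (subsetSum-∷ ps a as k j))
    (solve 3 (λ s x y → (:- con 1ℚ :* s) :* (y :+ x) := (:- con 1ℚ :* s) :* x :+ :- (s :* y)) refl (sgn k) (C (suc k)) (C′ k))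
  top-vanishes : sgn (suc n) * C (suc n) ≡ 0ℚ
  top-vanishes = trans (cong (λ Ss → sgn (suc n) * Σℚ (map (λ S → poly (ps ++ map ℤ.+_ S) j) Ss))
                             (length<⇒choose≡[] (suc n) as ℕₚ.≤-refl))
                       (ℚₚ.*-zeroʳ (sgn (suc n)))

poly-++-negatives : ∀ ps as → All (0 <_) as → ∀ j →
  poly (ps ++ map (λ a → ℤ.- (ℤ.+ a)) as) j ≡ inclusionExclusion ps as j
poly-++-negatives ps [] [] j = begin
  poly (ps ++ []) j                                     ≡⟨ solve 1 (λ x → x := con 1ℚ :* (x :+ con 0ℚ) :+ con 0ℚ) refl (poly (ps ++ []) j) ⟩
  inclusionExclusion ps [] j                            ∎
  where open ≡-Reasoning
poly-++-negatives ps (suc a ∷ as) (_ ∷ pos) j = begin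
  poly (ps ++ ℤ.- (ℤ.+ suc a) ∷ M) j                        ≡⟨ poly-neg ps (ℤ.+ suc a) M (ℕ→ℚ-suc≢0 a) j ⟩
  poly (ps ++ M) j + - poly (ps ++ ℤ.+ suc a ∷ M) j
    ≡⟨ cong₂ (λ x y → x + - y) (poly-++-negatives ps as pos j)
         (trans (cong (λ cs → poly cs j) (sym (Listₚ.++-assoc ps (ℤ.+ suc a ∷ []) M))) (poly-++-negatives (ps ++ ℤ.+ suc a ∷ []) as pos j)) ⟩
  inclusionExclusion ps as j + - inclusionExclusion (ps ++ ℤ.+ suc a ∷ []) as j ≡⟨ sym (inclusionExclusion-∷ ps (suc a) as j) ⟩
  inclusionExclusion ps (suc a ∷ as) j                      ∎
  where
  open ≡-Reasoning
  M : List ℤ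
  M = map (λ a → ℤ.- (ℤ.+ a)) as

-- Positivity only rules out a
-- parameter 0, for which the prefactor 1/(c₁⋯c_d) of poly is the junk value inv 0 = 0.
lemma24 : (as : List ℕ) → All (λ a → 0 < a) as → PairwiseCoprime as →
    (j : ℕ) →
    poly (map (λ a → ℤ.- (ℤ.+ a)) as) j
      ≡ ΣP (map (λ k → sgn (suc k) ⊙ ΣP (map (λ S → poly (map ℤ.+_ S)) (choose (suc k) as)))
                (upTo (length as))) j
lemma24 as pos _ j = begin
  poly (map (λ a → ℤ.- (ℤ.+ a)) as) j                       ≡⟨ poly-++-negatives [] as pos j ⟩
  sgn 0 * (poly [] j + 0ℚ) + ∑ n (λ k → sgn (suc k) * subsetSum [] as (suc k) j)
    ≡⟨ cong (λ x → sgn 0 * (x + 0ℚ) + ∑ n (λ k → sgn (suc k) * subsetSum [] as (suc k) j)) (poly-[] j) ⟩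
  0ℚ + ∑ n (λ k → sgn (suc k) * subsetSum [] as (suc k) j)  ≡⟨ ℚₚ.+-identityˡ _ ⟩
  ∑ n (λ k → sgn (suc k) * subsetSum [] as (suc k) j)
    ≡⟨ ∑-cong n (λ k → cong (sgn (suc k) *_) (sym (ΣP-apply (λ S → poly (map ℤ.+_ S)) (choose (suc k) as) j))) ⟩
  ∑ n (λ k → term k j)                                      ≡⟨ sym (trans (ΣP-apply term (upTo n) j) (Σ<≡∑ n (λ k → term k j))) ⟩
  ΣP (map term (upTo n)) j                                  ∎
  where
  open ≡-Reasoning
  n : ℕ
  n = length as
  term : ℕ → Poly
  term k = sgn (suc k) ⊙ ΣP (map (λ S → poly (map ℤ.+_ S)) (choose (suc k) as))
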